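{- Let $d=(d_1,\ldots,d_n)$ be a non-increasing sequence of positive integers, $\gamma\in[1,n]$, and $G_{d,\gamma}$ the flow network described in the context. Then $c(S,T)\ge\sum_{i=1}^n d_i$ for every $(S,T)\in\mathscr F_3$ if and only if $\sum_{i=1}^{\gamma}d_i\ge n-\gamma$ and for every $k\in[0,d_1]$: $\sum_{i=\gamma+1}^{\gamma+k}d_i\le k(k-1)+\sum_{i=1}^{\gamma}\min\{k,d_i\}+\sum_{i=\gamma+k+1}^{n}\min\{k,d_i-1\}$.
   Context: The network $G_{d,\gamma}$ has node set $\mathcal V=\{s,t\}\cup X\cup Y\cup X'_S\cup Y'_S$, where $X=\{x_1,\ldots,x_n\}$, $Y=\{y_1,\ldots,y_n\}$, $X'_S=\{x'_i:i\in[\gamma+1,n]\}$, $Y'_S=\{y'_j:j\in[\gamma+1,n]\}$. Its directed edges with capacities are: $(s,x_i)$ cap. $d_i$ and $(y_i,t)$ cap. $d_i$ for $i\in[1,n]$; $(x_i,y_j)$ cap. 1 for $i,j\in[1,\gamma]$, $i\ne j$; $(x_i,y_j)$ cap. 1 for $i\in[1,\gamma]$, $j\in[\gamma+1,n]$; $(x_i,y_j)$ cap. 1 for $i\in[\gamma+1,n]$, $j\in[1,\gamma]$; $(x_i,x'_i)$ cap. $d_i-1$ and $(y'_i,y_i)$ cap. $d_i-1$ for $i\in[\gamma+1,n]$; $(x'_i,y'_j)$ cap. 1 for $i,j\in[\gamma+1,n]$, $i\ne j$. An $s$-$t$ cut is a partition $(S,T)$ of $\mathcal V$ with $s\in S$,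 $t\in T$; its capacity $c(S,T)$ is the total capacity of edges directed from $S$ to $T$. $\mathscr F_3$ is the family of cuts $(S,\mathcal V\setminus S)$ with $S=\{s\}\cup\{x_i,x'_i:i\in I\}\cup\{y_j:j\in J\cap[1,\gamma]\}\cup\{y'_j:j\in J\cap[\gamma+1,n]\}$ for $I\subseteq[\gamma+1,n]$, $J\subseteq[1,n]$. $[a,b]=\{a,\ldots,b\}$. -}

module Defs where

open import Data.Nat using (ℕ; zero; suc; _+_; _*_; _∸_; _⊓_; _<ᵇ_; _≡ᵇ_; _≤_)
open import Data.Bool using (Bool; true; false; _∧_; _∨_; not; if_then_else_)
open import Data.Fin using (Fin; toℕ)
open import Data.Nat.ListAction using (sum)
open import Data.List using (List; _∷_; []; map; upTo; allFin; filterᵇ; _++_)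

-- Sum of f i for i ∈ [a,b] = {a,…,b} (empty if b < a).
sumRange : ℕ → ℕ → (ℕ → ℕ) → ℕ
sumRange a b f = sum (map (λ i → f (a + i)) (upTo (suc b ∸ a)))

-- 1-indexed view of d : Fin n → ℕ; D i = d_i for i ∈ [1,n], and 0 outside.
ext : (n : ℕ) → (Fin n → ℕ) → ℕ → ℕ
ext zero d i = 0
ext (suc n) d zero = 0
ext (suc n) d (suc zero) = d Fin.zero
  where import Data.Fin as Fin
ext (suc n) d (suc (suc i)) = ext n (λ j → d (Fin.suc j)) (suc i)
  where import Data.Fin as Fin

-- Nodes of G_{d,γ}.  Index i : Fin n stands for paper index toℕ i + 1.
data Node (n : ℕ) : Set where
  s t : Node n
  x y x′ y′ : Fin n → Node n

module Network (n : ℕ) (d : Fin n → ℕ) (γ : ℕ) where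

  -- paper index in [1,γ]
  lo : Fin n → Bool
  lo i = toℕ i <ᵇ γ

  hi : Fin n → Bool
  hi i = not (lo i)

  eqF : Fin n → Fin n → Bool
  eqF i j = toℕ i ≡ᵇ toℕ j

  nodes : List (Node n)
  nodes = s ∷ t ∷ (map x (allFin n) ++ map y (allFin n)
            ++ map x′ (filterᵇ hi (allFin n)) ++ map y′ (filterᵇ hi (allFin n)))

  cap : Node n → Node n → ℕ
  cap s (x i) = d i
  cap (y i) t = d i
  cap (x i) (y j) =
    if (lo i ∧ lo j ∧ not (eqF i j)) ∨ (lo i ∧ hi j) ∨ (hi i ∧ lo j) then 1 else 0
  cap (x i) (x′ j) = if hi i ∧ eqF i j then d i ∸ 1 else 0
  cap (y′ i) (y j) = if hi i ∧ eqF i j then d i ∸ 1 else 0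
  cap (x′ i) (y′ j) = if hi i ∧ hi j ∧ not (eqF i j) then 1 else 0
  cap _ _ = 0

  cutCap : (Node n → Bool) → ℕ
  cutCap inS = sum (map (λ u → sum (map (λ v →
      if inS u ∧ not (inS v) then cap u v else 0) nodes)) nodes)

  F3set : (I J : Fin n → Bool) → Node n → Bool
  F3set I J s = true
  F3set I J t = false
  F3set I J (x i) = I i
  F3set I J (x′ i) = I i
  F3set I J (y j) = J j ∧ lo j
  F3set I J (y′ j) = J j ∧ hi j

{-# OPTIONS --safe #-}
-- For the cut (S, 𝒱 ∖ S) of 𝓕₃ given by I ⊆ [γ+1,n] and J, the capacity is Σ_{i∉I} d_i plus, for every
-- column j, either the capacity d_j − [j > γ] of the edge leaving y_j (j ≤ γ) resp. y′_j (j > γ)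
-- when j ∈ J, or the number |I ∖ {j}| of unit edges entering it from S when j ∉ J.  Minimising
-- over J, the cut condition says Σ_{i∈I} d_i ≤ Σ_j min(|I ∖ {j}|, d_j − [j > γ]) for every
-- I ⊆ [γ+1,n], and I = [γ+1,n] resp. I = [γ+1,γ+k] give the two conditions of the theorem.
-- Conversely, split I into the p heavy elements (d_i > |I|) and the r light ones.  A light i
-- is paid for by its own column up to one unit.  The heavy ones are paid for by the condition
-- for k = p, applied after replacing them by [γ+1,γ+p]; since d is non-increasing, this can only
-- increase Σ (d_i + min(p, d_i − 1)).  The r missing units come from the columns j ≤ γ, where
-- min(p + r, d_j) − min(p, d_j) sums to at least r: if p > 0 because d_1 > |I| = p + r, and if
-- p = 0 by the first condition.
module Submission where

open import Data.Bool using (Bool; true; false; _∧_; _∨_; not; if_then_else_)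
open import Data.Bool.Properties
  using (not-injective; ∧-comm; ∧-identityʳ; ∧-zeroʳ; ∧-conicalˡ; ∧-conicalʳ; if-eta; if-∧; if-swap-then; T-≡)
open import Data.Fin using (Fin; toℕ; fromℕ<) renaming (zero to fzero; suc to fsuc; _≤_ to _≤ᶠ_)
open import Data.Fin.Properties using (toℕ<n; toℕ-injective; toℕ-fromℕ<)
open import Data.List using (List; []; _∷_; _++_; map; tabulate; allFin; applyUpTo; upTo; filterᵇ)
open import Data.List.Properties using (map-tabulate; map-upTo; map-++; map-∘; map-cong)
open import Data.Nat using (ℕ; zero; suc; _+_; _*_; _∸_; _⊓_; _≤_; _<_; _≤ᵇ_; _<ᵇ_; _≡ᵇ_; z≤n; z<s)
open import Data.Nat.ListAction using (sum)
open import Data.Nat.ListAction.Properties using (sum-++)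
open import Data.Nat.Properties
open import Data.Nat.Tactic.RingSolver using (solve-∀)
open import Data.Product using (∃; _,_; _×_)
open import Data.Sum using (_⊎_; inj₁; inj₂)
open import Function using (id; _∘_; _⇔_; mk⇔; Equivalence)
open import Function.Properties.Equivalence using () renaming (trans to ⇔-trans)
open import Relation.Binary.PropositionalEquality
  using (_≡_; refl; sym; trans; cong; cong₂; subst; _≗_; module ≡-Reasoning)
open import Relation.Nullary.Negation using (contradiction)
open import Relation.Nullary.Reflects using (ofʸ; ofⁿ)

open import Algebra.Properties.CommutativeSemigroup +-commutativeSemigroup
  using (interchange; xy∙z≈x∙zy; x∙yz≈xz∙y)
open import Algebra.Properties.Semiring.Sum +-*-semiring
  using (sum-syntax; sum-cong-≗; sum-replicate-zero; ∑-distrib-+; *-distribʳ-sum)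
  renaming (sum to ∑)

open import Defs

-- Sums over subsets of Fin n

Subset : ℕ → Set
Subset n = Fin n → Bool

private variable
  n : ℕ
  B C : Subset n
  f g : Fin n → ℕ

infixr 8 [_]·_
infixl 7 _∩_ _∖_
infix  4 _⊆_

[_]·_ : Bool → ℕ → ℕ
[ b ]· v = if b then v else 0

∁ : Subset n → Subset n
∁ B i = not (B i)

_∩_ _∖_ : Subset n → Subset n → Subset n
(B ∩ C) i = B i ∧ C i
(B ∖ C) i = B i ∧ not (C i)

-- Oriented like Network.eqF, so that ｛ i ｝ j is eqF i j.
｛_｝ : Fin n → Subset n
｛ j ｝ i = toℕ j ≡ᵇ toℕ i

_⊆_ : Subset n → Subset n → Set
B ⊆ C = ∀ i → B i ≡ true → C i ≡ true

sumOver : Subset n → (Fin n → ℕ) → ℕ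
sumOver B f = ∑ (λ i → [ B i ]· f i)

infixl 10 sumOver
syntax sumOver B (λ i → x) = ∑[ i ∈ B ] x

∣_∣ : Subset n → ℕ
∣ B ∣ = ∑[ _ ∈ B ] 1

∑-mono-≤ : ∀ {n} {f g : Fin n → ℕ} → (∀ i → f i ≤ g i) → ∑ f ≤ ∑ g
∑-mono-≤ {zero}  f≤g = z≤n
∑-mono-≤ {suc n} f≤g = +-mono-≤ (f≤g fzero) (∑-mono-≤ (f≤g ∘ fsuc))

∑-zero : ∀ {n} {f : Fin n → ℕ} → (∀ i → f i ≡ 0) → ∑ f ≡ 0
∑-zero {n} f≗0 = trans (sum-cong-≗ f≗0) (sum-replicate-zero n)

[]·-cong : ∀ {b u v} → (b ≡ true → u ≡ v) → [ b ]· u ≡ [ b ]· v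
[]·-cong {true}  u≡v = u≡v refl
[]·-cong {false} _   = refl

[]·-mono : ∀ {b u v} → (b ≡ true → u ≤ v) → [ b ]· u ≤ [ b ]· v
[]·-mono {true}  u≤v = u≤v refl
[]·-mono {false} _   = z≤n

[]·-distrib-+ : ∀ b {u v} → [ b ]· (u + v) ≡ [ b ]· u + [ b ]· v
[]·-distrib-+ true  = refl
[]·-distrib-+ false = refl

[]·-split : ∀ c b {v} → [ c ]· v ≡ [ c ∧ b ]· v + [ c ∧ not b ]· v
[]·-split true  true  = sym (+-identityʳ _)
[]·-split true  false = refl
[]·-split false _     = refl

∧-absorbs-⇒ : ∀ {c b} → (b ≡ true → c ≡ true) → c ∧ b ≡ b
∧-absorbs-⇒ {true}          _   = refl
∧-absorbs-⇒ {false} {false} _   = refl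
∧-absorbs-⇒ {false} {true}  b⇒c = b⇒c refl

sumOver-cong : (∀ i → B i ≡ true → f i ≡ g i) → ∑[ i ∈ B ] f i ≡ ∑[ i ∈ B ] g i
sumOver-cong f≡g = sum-cong-≗ λ i → []·-cong (f≡g i)

sumOver-mono : (∀ i → B i ≡ true → f i ≤ g i) → ∑[ i ∈ B ] f i ≤ ∑[ i ∈ B ] g i
sumOver-mono f≤g = ∑-mono-≤ λ i → []·-mono (f≤g i)

sumOver-≗ : B ≗ C → ∑[ i ∈ B ] f i ≡ ∑[ i ∈ C ] f i
sumOver-≗ {f = f} B≗C = sum-cong-≗ λ i → cong ([_]· f i) (B≗C i)

sumOver-zero : (B : Subset n) → (∀ i → B i ≡ true → f i ≡ 0) → ∑[ i ∈ B ] f i ≡ 0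
sumOver-zero B f≡0 = trans (sumOver-cong f≡0) (∑-zero λ i → if-eta (B i))

sumOver-+ : (B : Subset n) → ∑[ i ∈ B ] (f i + g i) ≡ ∑[ i ∈ B ] f i + ∑[ i ∈ B ] g i
sumOver-+ {f = f} {g = g} B =
  trans (sum-cong-≗ λ i → []·-distrib-+ (B i)) (∑-distrib-+ (λ i → [ B i ]· f i) (λ i → [ B i ]· g i))

sumOver-split : (C B : Subset n) → ∑[ i ∈ C ] f i ≡ ∑[ i ∈ C ∩ B ] f i + ∑[ i ∈ C ∖ B ] f i
sumOver-split {f = f} C B =
  trans (sum-cong-≗ λ i → []·-split (C i) (B i)) (∑-distrib-+ (λ i → [ (C ∩ B) i ]· f i) (λ i → [ (C ∖ B) i ]· f i))

∑-split : (B : Subset n) → ∑ f ≡ ∑[ i ∈ B ] f i + ∑[ i ∈ ∁ B ] f i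
∑-split B = sumOver-split (λ _ → true) B

sumOver-∩ : (B C : Subset n) → ∑[ i ∈ B ] ([ C i ]· f i) ≡ ∑[ i ∈ B ∩ C ] f i
sumOver-∩ B C = sum-cong-≗ λ i → sym (if-∧ (B i))

sumOver-restrict : B ⊆ C → ∑[ i ∈ C ] ([ B i ]· f i) ≡ ∑[ i ∈ B ] f i
sumOver-restrict {B = B} {C = C} {f = f} B⊆C =
  trans (sumOver-∩ {f = f} C B) (sumOver-≗ λ i → ∧-absorbs-⇒ (B⊆C i))

sumOver-split-⊆ : B ⊆ C → ∑[ i ∈ C ] f i ≡ ∑[ i ∈ B ] f i + ∑[ i ∈ C ∖ B ] f i
sumOver-split-⊆ {B = B} {C = C} {f = f} B⊆C =
  trans (sumOver-split C B)
        (cong (_+ ∑[ i ∈ C ∖ B ] f i) (trans (sym (sumOver-∩ {f = f} C B)) (sumOver-restrict B⊆C)))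

sumOver-const : (B : Subset n) (K : ℕ) → ∑[ _ ∈ B ] K ≡ ∣ B ∣ * K
sumOver-const B K = trans (sum-cong-≗ λ i → pointwise (B i)) (sym (*-distribʳ-sum K (λ i → [ B i ]· 1)))
  where
  pointwise : ∀ b → [ b ]· K ≡ [ b ]· 1 * K
  pointwise true  = sym (*-identityˡ K)
  pointwise false = refl

sumOver-≤-* : (B : Subset n) (K : ℕ) → (∀ i → B i ≡ true → f i ≤ K) → ∑[ i ∈ B ] f i ≤ ∣ B ∣ * K
sumOver-≤-* B K f≤K = ≤-trans (sumOver-mono f≤K) (≤-reflexive (sumOver-const B K))

*-≤-sumOver : (B : Subset n) (K : ℕ) → (∀ i → B i ≡ true → K ≤ f i) → ∣ B ∣ * K ≤ ∑[ i ∈ B ] f i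
*-≤-sumOver B K K≤f = ≤-trans (≤-reflexive (sym (sumOver-const B K))) (sumOver-mono K≤f)

sumOver-pred : (B : Subset n) → (∀ i → B i ≡ true → 1 ≤ f i) → ∑[ i ∈ B ] f i ≡ ∑[ i ∈ B ] (f i ∸ 1) + ∣ B ∣
sumOver-pred B 1≤f = trans (sumOver-cong λ i Bi → sym (m∸n+n≡m (1≤f i Bi))) (sumOver-+ B)

∣∣-mono-⊆ : B ⊆ C → ∣ B ∣ ≤ ∣ C ∣
∣∣-mono-⊆ {B = B} {C = C} B⊆C = ≤-trans (m≤m+n ∣ B ∣ ∣ C ∖ B ∣) (≤-reflexive (sym (sumOver-split-⊆ B⊆C)))

∣∣≡0⊎nonempty : (B : Subset n) → ∣ B ∣ ≡ 0 ⊎ ∃ λ i → B i ≡ true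
∣∣≡0⊎nonempty {zero}  B = inj₁ refl
∣∣≡0⊎nonempty {suc n} B with B fzero in B0
... | true  = inj₂ (fzero , B0)
... | false with ∣∣≡0⊎nonempty (B ∘ fsuc)
...   | inj₁ ∣B∣≡0    = inj₁ ∣B∣≡0
...   | inj₂ (i , Bi) = inj₂ (fsuc i , Bi)

｛｝-sound : ∀ {i j : Fin n} → ｛ j ｝ i ≡ true → j ≡ i
｛｝-sound {i = i} {j} j≡ᵇi = toℕ-injective (≡ᵇ⇒≡ (toℕ j) (toℕ i) (Equivalence.from T-≡ j≡ᵇi))

∑-｛｝ : (j : Fin n) (f : Fin n → ℕ) → ∑[ i ∈ ｛ j ｝ ] f i ≡ f j
∑-｛｝ {suc n} fzero    f = trans (cong (f fzero +_) (∑-zero {n} λ _ → refl)) (+-identityʳ (f fzero))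
∑-｛｝ {suc n} (fsuc j) f = ∑-｛｝ j (f ∘ fsuc)

sumOver-∩-｛｝ : (B : Subset n) (j : Fin n) → ∑[ i ∈ B ∩ ｛ j ｝ ] f i ≡ [ B j ]· f j
sumOver-∩-｛｝ {f = f} B j =
  trans (sum-cong-≗ λ i → trans (if-∧ (B i)) (if-swap-then (B i) (｛ j ｝ i))) (∑-｛｝ j (λ i → [ B i ]· f i))

∣∣-remove : (B : Subset n) (j : Fin n) → ∣ B ∣ ≡ ∣ B ∖ ｛ j ｝ ∣ + [ B j ]· 1
∣∣-remove B j =
  trans (sumOver-split B ｛ j ｝)
        (trans (cong (_+ ∣ B ∖ ｛ j ｝ ∣) (sumOver-∩-｛｝ B j)) (+-comm ([ B j ]· 1) ∣ B ∖ ｛ j ｝ ∣))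

∣∖｛｝∣-∉ : (B : Subset n) (j : Fin n) → B j ≡ false → ∣ B ∖ ｛ j ｝ ∣ ≡ ∣ B ∣
∣∖｛｝∣-∉ B j Bj =
  sym (trans (∣∣-remove B j) (trans (cong (λ b → ∣ B ∖ ｛ j ｝ ∣ + [ b ]· 1) Bj) (+-identityʳ _)))

∣∖｛｝∣-∈ : (B : Subset n) (j : Fin n) → B j ≡ true → ∣ B ∖ ｛ j ｝ ∣ ≡ ∣ B ∣ ∸ 1
∣∖｛｝∣-∈ B j Bj =
  sym (trans (cong (_∸ 1) (trans (∣∣-remove B j) (cong (λ b → ∣ B ∖ ｛ j ｝ ∣ + [ b ]· 1) Bj)))
             (m+n∸n≡m ∣ B ∖ ｛ j ｝ ∣ 1))

∑-∣∖｛｝∣+∣∩∣ : (I A : Subset n) → ∑[ i ∈ I ] ∣ A ∖ ｛ i ｝ ∣ + ∣ I ∩ A ∣ ≡ ∣ I ∣ * ∣ A ∣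
∑-∣∖｛｝∣+∣∩∣ I A = begin
  ∑[ i ∈ I ] ∣ A ∖ ｛ i ｝ ∣ + ∣ I ∩ A ∣
    ≡⟨ cong (∑[ i ∈ I ] ∣ A ∖ ｛ i ｝ ∣ +_) (sym (sumOver-∩ I A)) ⟩
  ∑[ i ∈ I ] ∣ A ∖ ｛ i ｝ ∣ + ∑[ i ∈ I ] ([ A i ]· 1)
    ≡⟨ sym (sumOver-+ I) ⟩
  ∑[ i ∈ I ] (∣ A ∖ ｛ i ｝ ∣ + [ A i ]· 1)
    ≡⟨ sumOver-cong (λ i _ → sym (∣∣-remove A i)) ⟩
  ∑[ _ ∈ I ] ∣ A ∣
    ≡⟨ sumOver-const I ∣ A ∣ ⟩
  ∣ I ∣ * ∣ A ∣ ∎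
  where open ≡-Reasoning

∑-∣∖｛｝∣-comm : (I A : Subset n) → ∑[ i ∈ I ] ∣ A ∖ ｛ i ｝ ∣ ≡ ∑[ k ∈ A ] ∣ I ∖ ｛ k ｝ ∣
∑-∣∖｛｝∣-comm I A = +-cancelʳ-≡ ∣ I ∩ A ∣ _ _ (begin
  ∑[ i ∈ I ] ∣ A ∖ ｛ i ｝ ∣ + ∣ I ∩ A ∣ ≡⟨ ∑-∣∖｛｝∣+∣∩∣ I A ⟩
  ∣ I ∣ * ∣ A ∣                         ≡⟨ *-comm ∣ I ∣ ∣ A ∣ ⟩
  ∣ A ∣ * ∣ I ∣                         ≡⟨ sym (∑-∣∖｛｝∣+∣∩∣ A I) ⟩
  ∑[ k ∈ A ] ∣ I ∖ ｛ k ｝ ∣ + ∣ A ∩ I ∣ ≡⟨ cong (∑[ k ∈ A ] ∣ I ∖ ｛ k ｝ ∣ +_) (sumOver-≗ λ i → ∧-comm (A i) (I i)) ⟩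
  ∑[ k ∈ A ] ∣ I ∖ ｛ k ｝ ∣ + ∣ I ∩ A ∣ ∎)
  where open ≡-Reasoning

∣∖∣-≤ : (B P : Subset n) → ∣ B ∣ ≤ ∣ P ∣ → ∣ B ∖ P ∣ ≤ ∣ P ∖ B ∣
∣∖∣-≤ B P ∣B∣≤∣P∣ = +-cancelˡ-≤ (∣ B ∩ P ∣) (∣ B ∖ P ∣) (∣ P ∖ B ∣) (begin
  ∣ B ∩ P ∣ + ∣ B ∖ P ∣ ≡⟨ sym (sumOver-split B P) ⟩
  ∣ B ∣                 ≤⟨ ∣B∣≤∣P∣ ⟩
  ∣ P ∣                 ≡⟨ sumOver-split P B ⟩
  ∣ P ∩ B ∣ + ∣ P ∖ B ∣ ≡⟨ cong (_+ ∣ P ∖ B ∣) (sumOver-≗ λ i → ∧-comm (P i) (B i)) ⟩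
  ∣ B ∩ P ∣ + ∣ P ∖ B ∣ ∎)
  where open ≤-Reasoning

sumOver-exchange : (B P : Subset n) (θ : ℕ) →
  (∀ i → (B ∖ P) i ≡ true → f i ≤ θ) → (∀ i → (P ∖ B) i ≡ true → θ ≤ f i) →
  ∣ B ∣ ≤ ∣ P ∣ → ∑[ i ∈ B ] f i ≤ ∑[ i ∈ P ] f i
sumOver-exchange {f = f} B P θ f≤θ θ≤f ∣B∣≤∣P∣ = begin
  ∑[ i ∈ B ] f i                          ≡⟨ sumOver-split B P ⟩
  ∑[ i ∈ B ∩ P ] f i + ∑[ i ∈ B ∖ P ] f i ≤⟨ +-monoʳ-≤ _ (sumOver-≤-* (B ∖ P) θ f≤θ) ⟩
  ∑[ i ∈ B ∩ P ] f i + ∣ B ∖ P ∣ * θ      ≤⟨ +-monoʳ-≤ _ (*-monoˡ-≤ θ (∣∖∣-≤ B P ∣B∣≤∣P∣)) ⟩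
  ∑[ i ∈ B ∩ P ] f i + ∣ P ∖ B ∣ * θ      ≤⟨ +-monoʳ-≤ _ (*-≤-sumOver (P ∖ B) θ θ≤f) ⟩
  ∑[ i ∈ B ∩ P ] f i + ∑[ i ∈ P ∖ B ] f i ≡⟨ cong (_+ ∑[ i ∈ P ∖ B ] f i) (sumOver-≗ λ i → ∧-comm (B i) (P i)) ⟩
  ∑[ i ∈ P ∩ B ] f i + ∑[ i ∈ P ∖ B ] f i ≡⟨ sym (sumOver-split P B) ⟩
  ∑[ i ∈ P ] f i                          ∎
  where open ≤-Reasoning

m⊓[n+o]≤m⊓n+m⊓o : ∀ m n o → m ⊓ (n + o) ≤ m ⊓ n + m ⊓ o
m⊓[n+o]≤m⊓n+m⊓o m n o = begin
  m ⊓ (n + o)                       ≤⟨ ⊓-glb (≤-trans (m⊓n≤m m (n + o)) (m≤n+m m (m ⊓ n)))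
                                             (⊓-glb (≤-trans (m⊓n≤m m (n + o)) (m≤m+n m o)) (m⊓n≤n m (n + o))) ⟩
  (m ⊓ n + m) ⊓ ((m + o) ⊓ (n + o)) ≡⟨ cong ((m ⊓ n + m) ⊓_) (sym (+-distribʳ-⊓ o m n)) ⟩
  (m ⊓ n + m) ⊓ (m ⊓ n + o)         ≡⟨ sym (+-distribˡ-⊓ (m ⊓ n) m o) ⟩
  m ⊓ n + m ⊓ o                     ∎
  where open ≤-Reasoning

[m+n]⊓o≡m⊓o+n⊓[o∸m] : ∀ m n o → (m + n) ⊓ o ≡ m ⊓ o + n ⊓ (o ∸ m)
[m+n]⊓o≡m⊓o+n⊓[o∸m] m n o with ≤-total m o
... | inj₁ m≤o = begin
  (m + n) ⊓ o              ≡⟨ cong ((m + n) ⊓_) (sym (m+[n∸m]≡n m≤o)) ⟩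
  (m + n) ⊓ (m + (o ∸ m))  ≡⟨ sym (+-distribˡ-⊓ m n (o ∸ m)) ⟩
  m + n ⊓ (o ∸ m)          ≡⟨ cong (_+ n ⊓ (o ∸ m)) (sym (m≤n⇒m⊓n≡m m≤o)) ⟩
  m ⊓ o + n ⊓ (o ∸ m)      ∎
  where open ≡-Reasoning
... | inj₂ o≤m = begin
  (m + n) ⊓ o              ≡⟨ m≥n⇒m⊓n≡n (≤-trans o≤m (m≤m+n m n)) ⟩
  o                        ≡⟨ sym (m≥n⇒m⊓n≡n o≤m) ⟩
  m ⊓ o                    ≡⟨ sym (+-identityʳ (m ⊓ o)) ⟩
  m ⊓ o + 0                ≡⟨ cong (m ⊓ o +_) (sym (trans (cong (n ⊓_) (m≤n⇒m∸n≡0 o≤m)) (⊓-zeroʳ n))) ⟩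
  m ⊓ o + n ⊓ (o ∸ m)      ∎
  where open ≡-Reasoning

+-pres-≡0 : ∀ {a b} → a ≡ 0 → b ≡ 0 → a + b ≡ 0
+-pres-≡0 refl refl = refl

m*[m∸1]+m*n≡m*[m+n∸1] : ∀ m n → m * (m ∸ 1) + m * n ≡ m * (m + n ∸ 1)
m*[m∸1]+m*n≡m*[m+n∸1] zero    n = refl
m*[m∸1]+m*n≡m*[m+n∸1] (suc m) n = sym (*-distribˡ-+ (suc m) m n)

⊓-∑-≤ : ∀ k (f : Fin n → ℕ) → k ⊓ ∑ f ≤ ∑[ i < n ] (k ⊓ f i)
⊓-∑-≤ {zero}  k f = ≤-reflexive (⊓-zeroʳ k)
⊓-∑-≤ {suc n} k f = ≤-trans (m⊓[n+o]≤m⊓n+m⊓o k (f fzero) (∑ (f ∘ fsuc)))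
                            (+-monoʳ-≤ (k ⊓ f fzero) (⊓-∑-≤ k (f ∘ fsuc)))

≤-sumOver⇒≤-sumOver-⊓ : ∀ k → k ≤ ∑[ i ∈ B ] f i → k ≤ ∑[ i ∈ B ] (k ⊓ f i)
≤-sumOver⇒≤-sumOver-⊓ {B = B} {f = f} k k≤∑ = begin
  k                              ≡⟨ sym (m≤n⇒m⊓n≡m k≤∑) ⟩
  k ⊓ ∑[ i ∈ B ] f i             ≤⟨ ⊓-∑-≤ k (λ i → [ B i ]· f i) ⟩
  ∑[ i < _ ] (k ⊓ [ B i ]· f i)  ≡⟨ sum-cong-≗ (λ i → pointwise (B i)) ⟩
  ∑[ i ∈ B ] (k ⊓ f i)           ∎
  where
  open ≤-Reasoning
  pointwise : ∀ b {v} → k ⊓ [ b ]· v ≡ [ b ]· (k ⊓ v)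
  pointwise true  = refl
  pointwise false = ⊓-zeroʳ k

sumOver-⊓-+ : (B : Subset n) (p r : ℕ) → r ≤ ∑[ i ∈ B ] (f i ∸ p) →
  ∑[ i ∈ B ] (p ⊓ f i) + r ≤ ∑[ i ∈ B ] ((p + r) ⊓ f i)
sumOver-⊓-+ {f = f} B p r r≤∑ = begin
  ∑[ i ∈ B ] (p ⊓ f i) + r                          ≤⟨ +-monoʳ-≤ _ (≤-sumOver⇒≤-sumOver-⊓ {B = B} r r≤∑) ⟩
  ∑[ i ∈ B ] (p ⊓ f i) + ∑[ i ∈ B ] (r ⊓ (f i ∸ p)) ≡⟨ sym (sumOver-+ B) ⟩
  ∑[ i ∈ B ] (p ⊓ f i + r ⊓ (f i ∸ p))              ≡⟨ sumOver-cong (λ i _ → sym ([m+n]⊓o≡m⊓o+n⊓[o∸m] p r (f i))) ⟩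
  ∑[ i ∈ B ] ((p + r) ⊓ f i)                        ∎
  where open ≤-Reasoning

≤-all-choices⇔≤-∑⊓ : ∀ X (f g : Fin n → ℕ) →
  (∀ (J : Subset n) → X ≤ ∑[ i ∈ ∁ J ] f i + ∑[ i ∈ J ] g i) ⇔ X ≤ ∑[ i < n ] (f i ⊓ g i)
≤-all-choices⇔≤-∑⊓ X f g = mk⇔
  (λ X≤ → ≤-trans (X≤ cheaper) (≤-reflexive (trans (sym (choose cheaper)) (sum-cong-≗ cheaper-cost))))
  (λ X≤ J → ≤-trans X≤ (≤-trans (∑-mono-≤ λ i → ⊓-≤-choice (J i)) (≤-reflexive (choose J))))
  where
  choose : ∀ J → ∑[ i < _ ] ([ not (J i) ]· f i + [ J i ]· g i) ≡ ∑[ i ∈ ∁ J ] f i + ∑[ i ∈ J ] g i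
  choose J = ∑-distrib-+ (λ i → [ not (J i) ]· f i) (λ i → [ J i ]· g i)
  ⊓-≤-choice : ∀ {u v} b → u ⊓ v ≤ [ not b ]· u + [ b ]· v
  ⊓-≤-choice {u} {v} true  = m⊓n≤n u v
  ⊓-≤-choice {u} {v} false = ≤-trans (m⊓n≤m u v) (m≤m+n u 0)
  cheaper : Subset _
  cheaper i = g i ≤ᵇ f i
  cheaper-cost : ∀ i → [ not (cheaper i) ]· f i + [ cheaper i ]· g i ≡ f i ⊓ g i
  cheaper-cost i with g i ≤ᵇ f i | ≤ᵇ-reflects-≤ (g i) (f i)
  ... | true  | ofʸ g≤f = sym (m≥n⇒m⊓n≡n g≤f)
  ... | false | ofⁿ g≰f = trans (+-identityʳ (f i)) (sym (m≤n⇒m⊓n≡m (<⇒≤ (≰⇒> g≰f))))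

-- Intervals of indices and sumRange

atLeast below : ℕ → Subset n
atLeast a i = not (toℕ i <ᵇ a)
below   b i = toℕ i <ᵇ b

<⇒<ᵇ≡true : ∀ {m k} → m < k → (m <ᵇ k) ≡ true
<⇒<ᵇ≡true m<k = Equivalence.to T-≡ (<⇒<ᵇ m<k)

≥⇒<ᵇ≡false : ∀ {m k} → k ≤ m → (m <ᵇ k) ≡ false
≥⇒<ᵇ≡false {m} {k} k≤m with m <ᵇ k | <ᵇ-reflects-< m k
... | false | _       = refl
... | true  | ofʸ m<k = contradiction k≤m (<⇒≱ m<k)

<ᵇ≡true⇒< : ∀ m k → (m <ᵇ k) ≡ true → m < k
<ᵇ≡true⇒< m k h = <ᵇ⇒< m k (Equivalence.from T-≡ h)

<ᵇ≡false⇒≥ : ∀ m k → (m <ᵇ k) ≡ false → k ≤ m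
<ᵇ≡false⇒≥ m k h = ≮⇒≥ λ m<k → contradiction (trans (sym (<⇒<ᵇ≡true m<k)) h) λ ()

below≡true⇒< : ∀ {b} {i : Fin n} → below b i ≡ true → toℕ i < b
below≡true⇒< {b = b} {i} = <ᵇ≡true⇒< (toℕ i) b

below≡false⇒≥ : ∀ {b} {i : Fin n} → below b i ≡ false → b ≤ toℕ i
below≡false⇒≥ {b = b} {i} = <ᵇ≡false⇒≥ (toℕ i) b

atLeast⇒≥ : ∀ {a} {i : Fin n} → atLeast a i ≡ true → a ≤ toℕ i
atLeast⇒≥ = below≡false⇒≥ ∘ not-injective

≥⇒atLeast : ∀ {a} {i : Fin n} → a ≤ toℕ i → atLeast a i ≡ true
≥⇒atLeast a≤i = cong not (≥⇒<ᵇ≡false a≤i)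

sumOver-∩-below : ∀ {b} {f : Fin n → ℕ} (B : Subset n) → n ≤ b → ∑[ i ∈ B ∩ below b ] f i ≡ ∑[ i ∈ B ] f i
sumOver-∩-below B n≤b =
  sumOver-≗ λ i → trans (cong (B i ∧_) (<⇒<ᵇ≡true (<-≤-trans (toℕ<n i) n≤b))) (∧-identityʳ (B i))

∣atLeast∩below∣ : ∀ a b → ∣ atLeast {n} a ∩ below b ∣ ≡ b ⊓ n ∸ a
∣atLeast∩below∣ {zero}  a       b       = sym (trans (cong (_∸ a) (⊓-zeroʳ b)) (0∸n≡0 a))
∣atLeast∩below∣ {suc n} zero    zero    = ∑-zero {n} λ _ → refl
∣atLeast∩below∣ {suc n} zero    (suc b) = cong suc (∣atLeast∩below∣ {n} 0 b)
∣atLeast∩below∣ {suc n} (suc a) zero    = trans (∣atLeast∩below∣ {n} a 0) (0∸n≡0 a)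
∣atLeast∩below∣ {suc n} (suc a) (suc b) = ∣atLeast∩below∣ {n} a b

atLeast∩below-∸ : ∀ a b → atLeast {n} a ∩ below (a + (b ∸ a)) ≗ atLeast a ∩ below b
atLeast∩below-∸ a b i with toℕ i <ᵇ a | <ᵇ-reflects-< (toℕ i) a | ≤-total a b
... | true  | _       | _        = refl
... | false | _       | inj₁ a≤b = cong (toℕ i <ᵇ_) (m+[n∸m]≡n a≤b)
... | false | ofⁿ i≮a | inj₂ b≤a = trans (≥⇒<ᵇ≡false (≤-trans (≤-reflexive a+[b∸a]≡a) (≮⇒≥ i≮a)))
                                         (sym (≥⇒<ᵇ≡false (≤-trans b≤a (≮⇒≥ i≮a))))
  where
  a+[b∸a]≡a : a + (b ∸ a) ≡ a
  a+[b∸a]≡a = trans (cong (a +_) (m≤n⇒m∸n≡0 b≤a)) (+-identityʳ a)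

Antitone : (Fin n → ℕ) → Set
Antitone f = ∀ i j → toℕ i ≤ toℕ j → f j ≤ f i

antitone⇒≤ext₁ : ∀ {f : Fin n → ℕ} → Antitone f → (i : Fin n) → f i ≤ ext n f 1
antitone⇒≤ext₁ {suc n} antitone i = antitone fzero i z≤n

antitone⇒≤sumOver-below : ∀ {γ} {f : Fin n → ℕ} → 1 ≤ γ → Antitone f → (i : Fin n) → f i ≤ ∑[ j ∈ below γ ] f j
antitone⇒≤sumOver-below {suc n} {suc γ} {f} _ antitone i = ≤-trans (antitone fzero i z≤n) (m≤m+n (f fzero) _)

sum-tabulate : (f : Fin n → ℕ) → sum (tabulate f) ≡ ∑ f
sum-tabulate {zero}  f = refl
sum-tabulate {suc n} f = cong (f fzero +_) (sum-tabulate (f ∘ fsuc))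

sum-map-allFin : (f : Fin n → ℕ) → sum (map f (allFin n)) ≡ ∑ f
sum-map-allFin {n} f = trans (cong sum (map-tabulate id f)) (sum-tabulate f)

sum-map-filterᵇ : ∀ {A : Set} (p : A → Bool) (f : A → ℕ) xs →
  sum (map f (filterᵇ p xs)) ≡ sum (map (λ z → [ p z ]· f z) xs)
sum-map-filterᵇ p f []       = refl
sum-map-filterᵇ p f (z ∷ xs) with p z
... | true  = cong (f z +_) (sum-map-filterᵇ p f xs)
... | false = sum-map-filterᵇ p f xs

sum-map-++ : ∀ {A : Set} (g : A → ℕ) xs ys → sum (map g (xs ++ ys)) ≡ sum (map g xs) + sum (map g ys)
sum-map-++ g xs ys = trans (cong sum (map-++ g xs ys)) (sum-++ (map g xs) (map g ys))

sum-map-zero : ∀ {A : Set} (xs : List A) → sum (map (λ _ → 0) xs) ≡ 0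
sum-map-zero []       = refl
sum-map-zero (_ ∷ xs) = sum-map-zero xs

sum-applyUpTo-zero : ∀ {g : ℕ → ℕ} L → (∀ i → g i ≡ 0) → sum (applyUpTo g L) ≡ 0
sum-applyUpTo-zero zero    g≗0 = refl
sum-applyUpTo-zero (suc L) g≗0 = cong₂ _+_ (g≗0 0) (sum-applyUpTo-zero L (g≗0 ∘ suc))

sum-applyUpTo-ext : ∀ n (d : Fin n → ℕ) (F : ℕ → ℕ) → F 0 ≡ 0 → ∀ a L →
  sum (applyUpTo (λ i → F (ext n d (suc (a + i)))) L) ≡ ∑[ i ∈ atLeast a ∩ below (a + L) ] F (d i)
sum-applyUpTo-ext zero    d F F0 a       L       = sum-applyUpTo-zero L (λ _ → F0)
sum-applyUpTo-ext (suc n) d F F0 (suc a) L       = sum-applyUpTo-ext n (d ∘ fsuc) F F0 a L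
sum-applyUpTo-ext (suc n) d F F0 zero    zero    = sym (∑-zero {n} λ _ → refl)
sum-applyUpTo-ext (suc n) d F F0 zero    (suc L) =
  cong (F (d fzero) +_) (sum-applyUpTo-ext n (d ∘ fsuc) F F0 zero L)

-- The paper index i + 1 is the Fin index i, so the range [a + 1, b] becomes a ≤ toℕ i < b;
-- F 0 ≡ 0 because ext pads with 0 beyond n.
sumRange-ext : ∀ n (d : Fin n → ℕ) (F : ℕ → ℕ) → F 0 ≡ 0 → ∀ a b →
  sumRange (a + 1) b (F ∘ ext n d) ≡ ∑[ i ∈ atLeast a ∩ below b ] F (d i)
sumRange-ext n d F F0 a b = begin
  sumRange (a + 1) b (F ∘ ext n d)
    ≡⟨ cong (λ c → sumRange c b (F ∘ ext n d)) (+-comm a 1) ⟩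
  sum (map (λ i → F (ext n d (suc (a + i)))) (upTo (b ∸ a)))
    ≡⟨ cong sum (map-upTo (λ i → F (ext n d (suc (a + i)))) (b ∸ a)) ⟩
  sum (applyUpTo (λ i → F (ext n d (suc (a + i)))) (b ∸ a))
    ≡⟨ sum-applyUpTo-ext n d F F0 a (b ∸ a) ⟩
  ∑[ i ∈ atLeast a ∩ below (a + (b ∸ a)) ] F (d i)
    ≡⟨ sumOver-≗ {f = F ∘ d} (atLeast∩below-∸ a b) ⟩
  ∑[ i ∈ atLeast a ∩ below b ] F (d i) ∎
  where open ≡-Reasoning

-- The cuts of 𝓕₃

module F3Cuts (n : ℕ) (d : Fin n → ℕ) (γ : ℕ) where
  open Network n d γ

  sum-nodes : (g : Node n → ℕ) → sum (map g nodes) ≡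
    g s + (g t + (∑[ i < n ] g (x i) + (∑[ i < n ] g (y i) + (∑[ i ∈ hi ] g (x′ i) + ∑[ i ∈ hi ] g (y′ i)))))
  sum-nodes g = cong (λ rest → g s + (g t + rest)) (begin
    sum (map g (X ++ Y ++ X′ ++ Y′))
      ≡⟨ sum-map-++ g X (Y ++ X′ ++ Y′) ⟩
    sum (map g X) + sum (map g (Y ++ X′ ++ Y′))
      ≡⟨ cong (sum (map g X) +_) (sum-map-++ g Y (X′ ++ Y′)) ⟩
    sum (map g X) + (sum (map g Y) + sum (map g (X′ ++ Y′)))
      ≡⟨ cong (λ z → sum (map g X) + (sum (map g Y) + z)) (sum-map-++ g X′ Y′) ⟩
    sum (map g X) + (sum (map g Y) + (sum (map g X′) + sum (map g Y′)))
      ≡⟨ cong₂ _+_ (all x) (cong₂ _+_ (all y) (cong₂ _+_ (high x′) (high y′))) ⟩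
    ∑[ i < n ] g (x i) + (∑[ i < n ] g (y i) + (∑[ i ∈ hi ] g (x′ i) + ∑[ i ∈ hi ] g (y′ i))) ∎)
    where
    open ≡-Reasoning
    X Y X′ Y′ : List (Node n)
    X  = map x (allFin n)
    Y  = map y (allFin n)
    X′ = map x′ (filterᵇ hi (allFin n))
    Y′ = map y′ (filterᵇ hi (allFin n))
    all : (u : Fin n → Node n) → sum (map g (map u (allFin n))) ≡ ∑[ i < n ] g (u i)
    all u = trans (cong sum (sym (map-∘ (allFin n)))) (sum-map-allFin (g ∘ u))
    high : (u : Fin n → Node n) → sum (map g (map u (filterᵇ hi (allFin n)))) ≡ ∑[ i ∈ hi ] g (u i)
    high u = trans (cong sum (sym (map-∘ (filterᵇ hi (allFin n)))))
                   (trans (sum-map-filterᵇ hi (g ∘ u) (allFin n)) (sum-map-allFin (λ i → [ hi i ]· g (u i))))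

  -- Capacity of the edge leaving y_j (j ≤ γ) or y′_j (j > γ).
  yCap : Fin n → ℕ
  yCap j = if lo j then d j else d j ∸ 1

  hi⇒lo≡false : ∀ {i} → hi i ≡ true → lo i ≡ false
  hi⇒lo≡false = not-injective

  ⊆hi⇒∉lo : ∀ {I} → I ⊆ hi → ∀ j → lo j ≡ true → I j ≡ false
  ⊆hi⇒∉lo {I} I⊆hi j lj with I j in Ij
  ... | false = refl
  ... | true  with () ← trans (sym lj) (hi⇒lo≡false (I⊆hi j Ij))

  yCap-lo : ∀ {j} → lo j ≡ true → yCap j ≡ d j
  yCap-lo {j} lj = cong (λ b → if b then d j else d j ∸ 1) lj

  yCap-hi : ∀ {j} → hi j ≡ true → yCap j ≡ d j ∸ 1
  yCap-hi {j} hj = cong (λ b → if b then d j else d j ∸ 1) (hi⇒lo≡false hj)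

  sumOver-yCap : (J : Subset n) → ∑[ j ∈ J ] yCap j ≡ ∑[ j ∈ J ∩ lo ] d j + ∑[ j ∈ J ∖ lo ] (d j ∸ 1)
  sumOver-yCap J = trans (sumOver-split J lo)
    (cong₂ _+_ (sumOver-cong λ j j∈ → yCap-lo (∧-conicalʳ (J j) (lo j) j∈))
               (sumOver-cong λ j j∈ → yCap-hi (∧-conicalʳ (J j) (hi j) j∈)))

  module _ (I J : Subset n) (I⊆hi : I ⊆ hi) where
    private
      S : Node n → Bool
      S = F3set I J

    flow : Node n → Node n → ℕ
    flow u v = [ not (S v) ]· cap u v

    outflow : Node n → ℕ
    outflow u = sum (map (flow u) nodes)

    cutCap-outflow : cutCap S ≡ sum (map (λ u → [ S u ]· outflow u) nodes)
    cutCap-outflow = cong sum (map-cong out nodes)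
      where
      out : ∀ u → sum (map (λ v → if S u ∧ not (S v) then cap u v else 0) nodes) ≡ [ S u ]· outflow u
      out u with S u
      ... | true  = refl
      ... | false = sum-map-zero nodes

    outflow-s : outflow s ≡ ∑[ i ∈ ∁ I ] d i
    outflow-s = trans (sum-nodes (flow s))
      (trans (cong (∑[ i ∈ ∁ I ] d i +_)
               (+-pres-≡0 (sumOver-zero (∁ (J ∩ lo)) λ _ _ → refl)
                 (+-pres-≡0 (sumOver-zero hi λ i _ → if-eta (not (I i)))
                            (sumOver-zero hi λ i _ → if-eta (not (J i ∧ hi i))))))
             (+-identityʳ _))

    outflow-x : ∀ i → I i ≡ true → outflow (x i) ≡ ∣ ∁ J ∩ lo ∣
    outflow-x i Ii = trans (sum-nodes (flow (x i)))
      (trans (cong₂ _+_ (sumOver-zero (∁ I) λ _ _ → refl)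
               (cong₂ _+_ (sum-cong-≗ λ k → x→y (hi⇒lo≡false (I⊆hi i Ii)) (J k) (lo k) (eqF i k))
                 (cong₂ _+_ (sumOver-zero hi λ k _ → x→x′ (λ e → subst (λ j → I j ≡ true) (｛｝-sound e) Ii)
                                                          (hi i) (d i ∸ 1))
                            (sumOver-zero hi λ k _ → if-eta (not (J k ∧ hi k))))))
             (+-identityʳ _))
      where
      x→y : ∀ {l} → l ≡ false → ∀ jk lk e →
        [ not (jk ∧ lk) ]· (if (l ∧ lk ∧ not e) ∨ (l ∧ not lk) ∨ (not l ∧ lk) then 1 else 0) ≡ [ not jk ∧ lk ]· 1
      x→y refl true  true  _ = refl
      x→y refl true  false _ = refl
      x→y refl false true  _ = refl
      x→y refl false false _ = refl
      x→x′ : ∀ {Ik e} → (e ≡ true → Ik ≡ true) → ∀ h v → [ not Ik ]· (if h ∧ e then v else 0) ≡ 0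
      x→x′ {true}          _   _     _ = refl
      x→x′ {false} {true}  e⇒I _     _ with () ← e⇒I refl
      x→x′ {false} {false} _   true  _ = refl
      x→x′ {false} {false} _   false _ = refl

    outflow-y : ∀ j → outflow (y j) ≡ d j
    outflow-y j = trans (sum-nodes (flow (y j)))
      (trans (cong (d j +_)
               (+-pres-≡0 (sumOver-zero (∁ I) λ _ _ → refl)
                 (+-pres-≡0 (sumOver-zero (∁ (J ∩ lo)) λ _ _ → refl)
                   (+-pres-≡0 (sumOver-zero hi λ k _ → if-eta (not (I k)))
                              (sumOver-zero hi λ k _ → if-eta (not (J k ∧ hi k)))))))
             (+-identityʳ (d j)))

    outflow-x′ : ∀ i → I i ≡ true → outflow (x′ i) ≡ ∣ (∁ J ∖ lo) ∖ ｛ i ｝ ∣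
    outflow-x′ i Ii = trans (sum-nodes (flow (x′ i)))
      (cong₂ _+_ (sumOver-zero (∁ I) λ _ _ → refl)
        (cong₂ _+_ (sumOver-zero (∁ (J ∩ lo)) λ _ _ → refl)
          (cong₂ _+_ (sumOver-zero hi λ k _ → if-eta (not (I k)))
                     (sum-cong-≗ λ k → x′→y′ (I⊆hi i Ii) (J k) (hi k) (eqF i k)))))
      where
      x′→y′ : ∀ {h} → h ≡ true → ∀ jk hk e →
        [ hk ]· [ not (jk ∧ hk) ]· (if h ∧ hk ∧ not e then 1 else 0) ≡ [ (not jk ∧ hk) ∧ not e ]· 1
      x′→y′ refl true  true  _ = refl
      x′→y′ refl true  false _ = refl
      x′→y′ refl false true  _ = refl
      x′→y′ refl false false _ = refl

    outflow-y′ : ∀ j → hi j ≡ true → outflow (y′ j) ≡ d j ∸ 1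
    outflow-y′ j hj = trans (sum-nodes (flow (y′ j)))
      (trans (cong₂ _+_ (sumOver-zero (∁ I) λ _ _ → refl)
               (cong₂ _+_ y′→y
                 (+-pres-≡0 (sumOver-zero hi λ k _ → if-eta (not (I k)))
                            (sumOver-zero hi λ k _ → if-eta (not (J k ∧ hi k))))))
             (+-identityʳ (d j ∸ 1)))
      where
      y′→y : ∑[ k < n ] ([ not (J k ∧ lo k) ]· (if hi j ∧ eqF j k then d j ∸ 1 else 0)) ≡ d j ∸ 1
      y′→y = begin
        ∑[ k < n ] ([ not (J k ∧ lo k) ]· (if hi j ∧ eqF j k then d j ∸ 1 else 0))
          ≡⟨ sum-cong-≗ (λ k → cong (λ h → [ not (J k ∧ lo k) ]· (if h ∧ eqF j k then d j ∸ 1 else 0)) hj) ⟩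
        ∑[ k < n ] ([ not (J k ∧ lo k) ]· [ ｛ j ｝ k ]· (d j ∸ 1))
          ≡⟨ sum-cong-≗ (λ k → if-swap-then (not (J k ∧ lo k)) (｛ j ｝ k)) ⟩
        ∑[ k ∈ ｛ j ｝ ] ([ not (J k ∧ lo k) ]· (d j ∸ 1))
          ≡⟨ ∑-｛｝ j (λ k → [ not (J k ∧ lo k) ]· (d j ∸ 1)) ⟩
        [ not (J j ∧ lo j) ]· (d j ∸ 1)
          ≡⟨ cong (λ l → [ not (J j ∧ l) ]· (d j ∸ 1)) (hi⇒lo≡false hj) ⟩
        [ not (J j ∧ false) ]· (d j ∸ 1)
          ≡⟨ cong (λ b → [ not b ]· (d j ∸ 1)) (∧-zeroʳ (J j)) ⟩
        d j ∸ 1 ∎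
        where open ≡-Reasoning

    cutCap-by-sources : cutCap (F3set I J) ≡
      ∑[ i ∈ ∁ I ] d i + (∑[ _ ∈ I ] ∣ ∁ J ∩ lo ∣ + (∑[ j ∈ J ∩ lo ] d j
        + (∑[ i ∈ I ] ∣ (∁ J ∖ lo) ∖ ｛ i ｝ ∣ + ∑[ j ∈ J ∖ lo ] (d j ∸ 1))))
    cutCap-by-sources = begin
      cutCap S
        ≡⟨ cutCap-outflow ⟩
      sum (map (λ u → [ S u ]· outflow u) nodes)
        ≡⟨ sum-nodes (λ u → [ S u ]· outflow u) ⟩
      outflow s + (∑[ i ∈ I ] outflow (x i) + (∑[ j ∈ J ∩ lo ] outflow (y j)
        + (∑[ i ∈ hi ] ([ I i ]· outflow (x′ i)) + ∑[ j ∈ hi ] ([ (J ∖ lo) j ]· outflow (y′ j)))))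
        ≡⟨ cong₂ _+_ outflow-s (cong₂ _+_ (sumOver-cong outflow-x) (cong₂ _+_ (sumOver-cong λ j _ → outflow-y j)
             (cong₂ _+_ (trans (sumOver-restrict I⊆hi) (sumOver-cong outflow-x′))
                        (trans (sumOver-restrict J∖lo⊆hi) (sumOver-cong λ j j∈ → outflow-y′ j (J∖lo⊆hi j j∈)))))) ⟩
      ∑[ i ∈ ∁ I ] d i + (∑[ _ ∈ I ] ∣ ∁ J ∩ lo ∣ + (∑[ j ∈ J ∩ lo ] d j
        + (∑[ i ∈ I ] ∣ (∁ J ∖ lo) ∖ ｛ i ｝ ∣ + ∑[ j ∈ J ∖ lo ] (d j ∸ 1)))) ∎
      where
      open ≡-Reasoning
      J∖lo⊆hi : J ∖ lo ⊆ hi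
      J∖lo⊆hi j = ∧-conicalʳ (J j) (hi j)

    cutCap-F3set : cutCap (F3set I J) ≡ ∑[ i ∈ ∁ I ] d i + (∑[ j ∈ ∁ J ] ∣ I ∖ ｛ j ｝ ∣ + ∑[ j ∈ J ] yCap j)
    cutCap-F3set = trans cutCap-by-sources (cong (∑[ i ∈ ∁ I ] d i +_) (begin
      ∑[ _ ∈ I ] ∣ ∁ J ∩ lo ∣ + (∑[ j ∈ J ∩ lo ] d j
        + (∑[ i ∈ I ] ∣ (∁ J ∖ lo) ∖ ｛ i ｝ ∣ + ∑[ j ∈ J ∖ lo ] (d j ∸ 1)))
        ≡⟨ cong₂ (λ a b → a + (∑[ j ∈ J ∩ lo ] d j + (b + ∑[ j ∈ J ∖ lo ] (d j ∸ 1))))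
                 low-columns (∑-∣∖｛｝∣-comm I (∁ J ∖ lo)) ⟩
      ∁J-lo + (J-lo + (∁J-hi + J-hi))
        ≡⟨ trans (sym (+-assoc ∁J-lo J-lo (∁J-hi + J-hi))) (interchange ∁J-lo J-lo ∁J-hi J-hi) ⟩
      (∁J-lo + ∁J-hi) + (J-lo + J-hi)
        ≡⟨ cong₂ _+_ (sym (sumOver-split (∁ J) lo)) (sym (sumOver-yCap J)) ⟩
      ∑[ j ∈ ∁ J ] ∣ I ∖ ｛ j ｝ ∣ + ∑[ j ∈ J ] yCap j ∎))
      where
      open ≡-Reasoning
      ∁J-lo J-lo ∁J-hi J-hi : ℕ
      ∁J-lo = ∑[ j ∈ ∁ J ∩ lo ] ∣ I ∖ ｛ j ｝ ∣
      J-lo  = ∑[ j ∈ J ∩ lo ] d j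
      ∁J-hi = ∑[ j ∈ ∁ J ∖ lo ] ∣ I ∖ ｛ j ｝ ∣
      J-hi  = ∑[ j ∈ J ∖ lo ] (d j ∸ 1)
      low-columns : ∑[ _ ∈ I ] ∣ ∁ J ∩ lo ∣ ≡ ∁J-lo
      low-columns = begin
        ∑[ _ ∈ I ] ∣ ∁ J ∩ lo ∣  ≡⟨ sumOver-const I ∣ ∁ J ∩ lo ∣ ⟩
        ∣ I ∣ * ∣ ∁ J ∩ lo ∣      ≡⟨ *-comm ∣ I ∣ ∣ ∁ J ∩ lo ∣ ⟩
        ∣ ∁ J ∩ lo ∣ * ∣ I ∣      ≡⟨ sym (sumOver-const (∁ J ∩ lo) ∣ I ∣) ⟩
        ∑[ _ ∈ ∁ J ∩ lo ] ∣ I ∣   ≡⟨ sumOver-cong (λ j j∈ → sym (∣∖｛｝∣-∉ I j (⊆hi⇒∉lo I⊆hi j (∧-conicalʳ _ _ j∈)))) ⟩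
        ∁J-lo                     ∎

  -- The least capacity of a cut of 𝓕₃ with x-part I is ∑[ ∁ I ] d + capacity I.
  capacity : Subset n → ℕ
  capacity I = ∑[ j < n ] (∣ I ∖ ｛ j ｝ ∣ ⊓ yCap j)

  all-cuts⇔capacity-bound : (I : Subset n) → I ⊆ hi →
    (∀ J → ∑[ i < n ] d i ≤ cutCap (F3set I J)) ⇔ ∑[ i ∈ I ] d i ≤ capacity I
  all-cuts⇔capacity-bound I I⊆hi = mk⇔
    (λ H → Equivalence.to choices (λ J → Equivalence.to (cancel J) (H J)))
    (λ H J → Equivalence.from (cancel J) (Equivalence.from choices H J))
    where
    choices : (∀ J → ∑[ i ∈ I ] d i ≤ ∑[ j ∈ ∁ J ] ∣ I ∖ ｛ j ｝ ∣ + ∑[ j ∈ J ] yCap j) ⇔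
              ∑[ i ∈ I ] d i ≤ capacity I
    choices = ≤-all-choices⇔≤-∑⊓ (∑[ i ∈ I ] d i) (λ j → ∣ I ∖ ｛ j ｝ ∣) yCap
    cancel : ∀ J → (∑[ i < n ] d i ≤ cutCap (F3set I J)) ⇔
                   (∑[ i ∈ I ] d i ≤ ∑[ j ∈ ∁ J ] ∣ I ∖ ｛ j ｝ ∣ + ∑[ j ∈ J ] yCap j)
    cancel J rewrite ∑-split {f = d} I | cutCap-F3set I J I⊆hi | +-comm (∑[ i ∈ I ] d i) (∑[ i ∈ ∁ I ] d i) =
      mk⇔ (+-cancelˡ-≤ (∑[ i ∈ ∁ I ] d i) _ _) (+-monoʳ-≤ (∑[ i ∈ ∁ I ] d i))

  capacity-split : (I : Subset n) → I ⊆ hi → capacity I ≡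
    ∑[ j ∈ lo ] (∣ I ∣ ⊓ d j) + ∑[ j ∈ I ] ((∣ I ∣ ∸ 1) ⊓ (d j ∸ 1)) + ∑[ j ∈ hi ∖ I ] (∣ I ∣ ⊓ (d j ∸ 1))
  capacity-split I I⊆hi = begin
    capacity I
      ≡⟨ ∑-split lo ⟩
    ∑[ j ∈ lo ] e j + ∑[ j ∈ hi ] e j
      ≡⟨ cong (∑[ j ∈ lo ] e j +_) (sumOver-split-⊆ I⊆hi) ⟩
    ∑[ j ∈ lo ] e j + (∑[ j ∈ I ] e j + ∑[ j ∈ hi ∖ I ] e j)
      ≡⟨ sym (+-assoc (∑[ j ∈ lo ] e j) (∑[ j ∈ I ] e j) (∑[ j ∈ hi ∖ I ] e j)) ⟩
    ∑[ j ∈ lo ] e j + ∑[ j ∈ I ] e j + ∑[ j ∈ hi ∖ I ] e j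
      ≡⟨ cong₂ _+_ (cong₂ _+_ (sumOver-cong low) (sumOver-cong inside)) (sumOver-cong outside) ⟩
    ∑[ j ∈ lo ] (∣ I ∣ ⊓ d j) + ∑[ j ∈ I ] ((∣ I ∣ ∸ 1) ⊓ (d j ∸ 1)) + ∑[ j ∈ hi ∖ I ] (∣ I ∣ ⊓ (d j ∸ 1)) ∎
    where
    open ≡-Reasoning
    e : Fin n → ℕ
    e j = ∣ I ∖ ｛ j ｝ ∣ ⊓ yCap j
    low : ∀ j → lo j ≡ true → e j ≡ ∣ I ∣ ⊓ d j
    low j lj = cong₂ _⊓_ (∣∖｛｝∣-∉ I j (⊆hi⇒∉lo I⊆hi j lj)) (yCap-lo lj)
    inside : ∀ j → I j ≡ true → e j ≡ (∣ I ∣ ∸ 1) ⊓ (d j ∸ 1)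
    inside j Ij = cong₂ _⊓_ (∣∖｛｝∣-∈ I j Ij) (yCap-hi (I⊆hi j Ij))
    outside : ∀ j → (hi ∖ I) j ≡ true → e j ≡ ∣ I ∣ ⊓ (d j ∸ 1)
    outside j j∈ = cong₂ _⊓_ (∣∖｛｝∣-∉ I j (not-injective (∧-conicalʳ (hi j) (not (I j)) j∈)))
                             (yCap-hi (∧-conicalˡ (hi j) (not (I j)) j∈))

  CutCondition CapacityCondition : Set
  CutCondition = (I J : Fin n → Bool) → (∀ i → I i ≡ true → γ ≤ toℕ i) →
    sumRange 1 n (ext n d) ≤ cutCap (F3set I J)
  CapacityCondition = ∀ I → I ⊆ hi → ∑[ i ∈ I ] d i ≤ capacity I

  cut-condition⇔capacity-condition : CutCondition ⇔ CapacityCondition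
  cut-condition⇔capacity-condition = mk⇔
    (λ H I I⊆hi → Equivalence.to (all-cuts⇔capacity-bound I I⊆hi)
                    λ J → subst (_≤ cutCap (F3set I J)) ∑d (H I J (λ i → atLeast⇒≥ ∘ I⊆hi i)))
    (λ H I J I≥γ → subst (_≤ cutCap (F3set I J)) (sym ∑d)
                    (Equivalence.from (all-cuts⇔capacity-bound I (≥γ⇒⊆hi I≥γ)) (H I (≥γ⇒⊆hi I≥γ)) J))
    where
    ∑d : sumRange 1 n (ext n d) ≡ ∑[ i < n ] d i
    ∑d = trans (sumRange-ext n d id refl 0 n) (sumOver-∩-below {f = d} (λ _ → true) ≤-refl)
    ≥γ⇒⊆hi : ∀ {I} → (∀ i → I i ≡ true → γ ≤ toℕ i) → I ⊆ hi
    ≥γ⇒⊆hi I≥γ i = ≥⇒atLeast ∘ I≥γ i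

  segment : ℕ → Subset n
  segment k = atLeast γ ∩ below (γ + k)

  SegmentCondition : ℕ → Set
  SegmentCondition k =
    ∑[ i ∈ segment k ] d i ≤ k * (k ∸ 1) + ∑[ i ∈ lo ] (k ⊓ d i) + ∑[ i ∈ atLeast (γ + k) ] (k ⊓ (d i ∸ 1))

  SegmentConditions SequenceConditions : Set
  SegmentConditions = (n ∸ γ ≤ ∑[ i ∈ lo ] d i) × (∀ k → k ≤ ext n d 1 → SegmentCondition k)
  SequenceConditions = (n ∸ γ ≤ sumRange 1 γ (ext n d)) ×
    (∀ k → k ≤ ext n d 1 →
      sumRange (γ + 1) (γ + k) (ext n d)
        ≤ k * (k ∸ 1) + sumRange 1 γ (λ i → k ⊓ ext n d i) + sumRange (γ + k + 1) n (λ i → k ⊓ (ext n d i ∸ 1)))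

  segment-conditions⇔sequence-conditions : SegmentConditions ⇔ SequenceConditions
  segment-conditions⇔sequence-conditions = mk⇔
    (λ (size , seg) → Equivalence.to size⇔ size , λ k k≤d₁ → Equivalence.to (segment⇔ k) (seg k k≤d₁))
    (λ (size , seg) → Equivalence.from size⇔ size , λ k k≤d₁ → Equivalence.from (segment⇔ k) (seg k k≤d₁))
    where
    ≤-cong-⇔ : ∀ {a a′ b b′} → a ≡ a′ → b ≡ b′ → (a ≤ b) ⇔ (a′ ≤ b′)
    ≤-cong-⇔ refl refl = mk⇔ id id
    size⇔ : (n ∸ γ ≤ ∑[ i ∈ lo ] d i) ⇔ (n ∸ γ ≤ sumRange 1 γ (ext n d))
    size⇔ = ≤-cong-⇔ refl (sym (sumRange-ext n d id refl 0 γ))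
    segment⇔ : ∀ k → SegmentCondition k ⇔
      (sumRange (γ + 1) (γ + k) (ext n d)
        ≤ k * (k ∸ 1) + sumRange 1 γ (λ i → k ⊓ ext n d i) + sumRange (γ + k + 1) n (λ i → k ⊓ (ext n d i ∸ 1)))
    segment⇔ k = ≤-cong-⇔ (sym (sumRange-ext n d id refl γ (γ + k)))
      (sym (cong₂ (λ a b → k * (k ∸ 1) + a + b)
             (sumRange-ext n d (k ⊓_) (⊓-zeroʳ k) 0 γ)
             (trans (sumRange-ext n d (λ z → k ⊓ (z ∸ 1)) (⊓-zeroʳ k) (γ + k) n)
                    (sumOver-∩-below {f = λ i → k ⊓ (d i ∸ 1)} (atLeast (γ + k)) ≤-refl))))

  ∣hi∣ : ∣ hi ∣ ≡ n ∸ γ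
  ∣hi∣ = begin
    ∣ hi ∣            ≡⟨ sym (sumOver-∩-below hi ≤-refl) ⟩
    ∣ hi ∩ below n ∣  ≡⟨ ∣atLeast∩below∣ γ n ⟩
    n ⊓ n ∸ γ         ≡⟨ cong (_∸ γ) (⊓-idem n) ⟩
    n ∸ γ             ∎
    where open ≡-Reasoning

  ⊆hi⇒∣∣≤ : ∀ {B} → B ⊆ hi → ∣ B ∣ ≤ n ∸ γ
  ⊆hi⇒∣∣≤ B⊆hi = ≤-trans (∣∣-mono-⊆ B⊆hi) (≤-reflexive ∣hi∣)

  segment⊆hi : ∀ k → segment k ⊆ hi
  segment⊆hi k i = ∧-conicalˡ (hi i) (below (γ + k) i)

  hi∖segment≗atLeast : ∀ k → hi ∖ segment k ≗ atLeast (γ + k)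
  hi∖segment≗atLeast k i with toℕ i <ᵇ γ | <ᵇ-reflects-< (toℕ i) γ
  ... | true  | ofʸ i<γ = sym (cong not (<⇒<ᵇ≡true (<-≤-trans i<γ (m≤m+n γ k))))
  ... | false | _       = refl

  ∣segment∣≤ : ∀ k → ∣ segment k ∣ ≤ k
  ∣segment∣≤ k = begin
    ∣ segment k ∣    ≡⟨ ∣atLeast∩below∣ γ (γ + k) ⟩
    (γ + k) ⊓ n ∸ γ  ≤⟨ ∸-monoˡ-≤ γ (m⊓n≤m (γ + k) n) ⟩
    γ + k ∸ γ        ≡⟨ m+n∸m≡n γ k ⟩
    k                ∎
    where open ≤-Reasoning

  ∣segment∣≡ : ∀ k → γ + k ≤ n → ∣ segment k ∣ ≡ k
  ∣segment∣≡ k γ+k≤n = begin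
    ∣ segment k ∣    ≡⟨ ∣atLeast∩below∣ γ (γ + k) ⟩
    (γ + k) ⊓ n ∸ γ  ≡⟨ cong (_∸ γ) (m≤n⇒m⊓n≡m γ+k≤n) ⟩
    γ + k ∸ γ        ≡⟨ m+n∸m≡n γ k ⟩
    k                ∎
    where open ≡-Reasoning

  capacity-condition⇒size-bound : (∀ i → 1 ≤ d i) → CapacityCondition → n ∸ γ ≤ ∑[ i ∈ lo ] d i
  capacity-condition⇒size-bound d≥1 H = +-cancelˡ-≤ (∑[ i ∈ hi ] (d i ∸ 1)) _ _ (begin
    ∑[ i ∈ hi ] (d i ∸ 1) + (n ∸ γ)         ≡⟨ cong (∑[ i ∈ hi ] (d i ∸ 1) +_) (sym ∣hi∣) ⟩
    ∑[ i ∈ hi ] (d i ∸ 1) + ∣ hi ∣          ≡⟨ sym (sumOver-pred hi (λ i _ → d≥1 i)) ⟩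
    ∑[ i ∈ hi ] d i                         ≤⟨ H hi (λ _ hi-i → hi-i) ⟩
    capacity hi                             ≤⟨ ∑-mono-≤ (λ j → m⊓n≤n _ (yCap j)) ⟩
    ∑[ j < n ] yCap j                       ≡⟨ sumOver-yCap (λ _ → true) ⟩
    ∑[ i ∈ lo ] d i + ∑[ i ∈ hi ] (d i ∸ 1) ≡⟨ +-comm (∑[ i ∈ lo ] d i) _ ⟩
    ∑[ i ∈ hi ] (d i ∸ 1) + ∑[ i ∈ lo ] d i ∎)
    where open ≤-Reasoning

  capacity-condition⇒segment-condition : CapacityCondition → ∀ k → SegmentCondition k
  capacity-condition⇒segment-condition H k = begin
    ∑[ i ∈ segment k ] d i
      ≤⟨ H (segment k) (segment⊆hi k) ⟩
    capacity (segment k)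
      ≡⟨ capacity-split (segment k) (segment⊆hi k) ⟩
    ∑[ i ∈ lo ] (c ⊓ d i) + ∑[ i ∈ segment k ] ((c ∸ 1) ⊓ (d i ∸ 1)) + ∑[ i ∈ hi ∖ segment k ] (c ⊓ (d i ∸ 1))
      ≤⟨ +-mono-≤ (+-mono-≤ (sumOver-mono λ i _ → ⊓-monoˡ-≤ (d i) c≤k)
                             (sumOver-≤-* (segment k) (k ∸ 1) λ i _ → ≤-trans (m⊓n≤m _ _) (∸-monoˡ-≤ 1 c≤k)))
                  (≤-trans (≤-reflexive (sumOver-≗ (hi∖segment≗atLeast k)))
                           (sumOver-mono λ i _ → ⊓-monoˡ-≤ (d i ∸ 1) c≤k)) ⟩
    L + c * (k ∸ 1) + R
      ≤⟨ +-monoˡ-≤ R (+-monoʳ-≤ L (*-monoˡ-≤ (k ∸ 1) c≤k)) ⟩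
    L + k * (k ∸ 1) + R
      ≡⟨ cong (_+ R) (+-comm L (k * (k ∸ 1))) ⟩
    k * (k ∸ 1) + L + R ∎
    where
    open ≤-Reasoning
    c L R : ℕ
    c = ∣ segment k ∣
    L = ∑[ i ∈ lo ] (k ⊓ d i)
    R = ∑[ i ∈ atLeast (γ + k) ] (k ⊓ (d i ∸ 1))
    c≤k : c ≤ k
    c≤k = ∣segment∣≤ k

  module _ (d≥1 : ∀ i → 1 ≤ d i) (antitone : Antitone d) (1≤γ : 1 ≤ γ) (γ≤n : γ ≤ n) where

    -- Exchange argument with the last index of the segment as pivot.
    sumOver-≤-segment : ∀ {v} (B : Subset n) → Antitone v → B ⊆ hi → ∑[ i ∈ B ] v i ≤ ∑[ i ∈ segment ∣ B ∣ ] v i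
    sumOver-≤-segment {v} B v-antitone B⊆hi =
      sumOver-exchange B (segment k) (v pivot) outside inside (≤-reflexive (sym (∣segment∣≡ k γ+k≤n)))
      where
      open ≤-Reasoning
      k : ℕ
      k = ∣ B ∣
      γ+k≤n : γ + k ≤ n
      γ+k≤n = ≤-trans (+-monoʳ-≤ γ (⊆hi⇒∣∣≤ B⊆hi)) (≤-reflexive (m+[n∸m]≡n γ≤n))
      pivot : Fin n
      pivot = fromℕ< (<-≤-trans (∸-monoʳ-< z<s (≤-trans 1≤γ (m≤m+n γ k))) γ+k≤n)
      outside : ∀ i → (B ∖ segment k) i ≡ true → v i ≤ v pivot
      outside i i∈ = v-antitone pivot i (begin
        toℕ pivot  ≡⟨ toℕ-fromℕ< _ ⟩
        γ + k ∸ 1  ≤⟨ m∸n≤m (γ + k) 1 ⟩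
        γ + k      ≤⟨ below≡false⇒≥ (trans (cong (_∧ below (γ + k) i) (sym hi-i)) i∉segment) ⟩
        toℕ i      ∎)
        where
        hi-i : hi i ≡ true
        hi-i = B⊆hi i (∧-conicalˡ (B i) _ i∈)
        i∉segment : segment k i ≡ false
        i∉segment = not-injective (∧-conicalʳ (B i) _ i∈)
      inside : ∀ i → (segment k ∖ B) i ≡ true → v pivot ≤ v i
      inside i i∈ = v-antitone i pivot (begin
        toℕ i      ≤⟨ <⇒≤pred (below≡true⇒< {b = γ + k} (∧-conicalʳ (hi i) _ (∧-conicalˡ (segment k i) _ i∈))) ⟩
        γ + k ∸ 1  ≡⟨ sym (toℕ-fromℕ< _) ⟩
        toℕ pivot  ∎)

    subset-condition : (B : Subset n) → B ⊆ hi → SegmentCondition ∣ B ∣ →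
      ∑[ i ∈ B ] d i ≤ ∣ B ∣ * (∣ B ∣ ∸ 1) + ∑[ i ∈ lo ] (∣ B ∣ ⊓ d i) + ∑[ i ∈ hi ∖ B ] (∣ B ∣ ⊓ (d i ∸ 1))
    subset-condition B B⊆hi segment-condition = +-cancelʳ-≤ (∑[ i ∈ B ] w i) _ _ (begin
      ∑[ i ∈ B ] d i + ∑[ i ∈ B ] w i                  ≡⟨ sym (sumOver-+ B) ⟩
      ∑[ i ∈ B ] (d i + w i)                           ≤⟨ sumOver-≤-segment B v-antitone B⊆hi ⟩
      ∑[ i ∈ segment k ] (d i + w i)                   ≡⟨ sumOver-+ (segment k) ⟩
      ∑[ i ∈ segment k ] d i + ∑[ i ∈ segment k ] w i  ≤⟨ +-monoˡ-≤ (∑[ i ∈ segment k ] w i) segment-condition ⟩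
      K + L + R + ∑[ i ∈ segment k ] w i               ≡⟨ xy∙z≈x∙zy (K + L) R (∑[ i ∈ segment k ] w i) ⟩
      K + L + (∑[ i ∈ segment k ] w i + R)             ≡⟨ cong (K + L +_) (sym ∑hi-w) ⟩
      K + L + ∑[ i ∈ hi ] w i                          ≡⟨ cong (K + L +_) (sumOver-split-⊆ B⊆hi) ⟩
      K + L + (∑[ i ∈ B ] w i + ∑[ i ∈ hi ∖ B ] w i)   ≡⟨ x∙yz≈xz∙y (K + L) (∑[ i ∈ B ] w i) (∑[ i ∈ hi ∖ B ] w i) ⟩
      K + L + ∑[ i ∈ hi ∖ B ] w i + ∑[ i ∈ B ] w i     ∎)
      where
      open ≤-Reasoning
      k K L R : ℕ
      k = ∣ B ∣
      K = k * (k ∸ 1)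
      L = ∑[ i ∈ lo ] (k ⊓ d i)
      R = ∑[ i ∈ atLeast (γ + k) ] (k ⊓ (d i ∸ 1))
      w : Fin n → ℕ
      w i = k ⊓ (d i ∸ 1)
      v-antitone : Antitone (λ i → d i + w i)
      v-antitone i j i≤j = +-mono-≤ (antitone i j i≤j) (⊓-monoʳ-≤ k (∸-monoˡ-≤ 1 (antitone i j i≤j)))
      ∑hi-w : ∑[ i ∈ hi ] w i ≡ ∑[ i ∈ segment k ] w i + R
      ∑hi-w = trans (sumOver-split-⊆ (segment⊆hi k))
                    (cong (∑[ i ∈ segment k ] w i +_) (sumOver-≗ (hi∖segment≗atLeast k)))

    module HeavyLight (size : n ∸ γ ≤ ∑[ i ∈ lo ] d i)
                      (segment-conditions : ∀ k → k ≤ ext n d 1 → SegmentCondition k)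
                      (I : Subset n) (I⊆hi : I ⊆ hi) where

      c : ℕ
      c = ∣ I ∣

      large heavy light : Subset n
      large i = c <ᵇ d i
      heavy = I ∩ large
      light = I ∖ large

      p r : ℕ
      p = ∣ heavy ∣
      r = ∣ light ∣

      c≡p+r : c ≡ p + r
      c≡p+r = sumOver-split I large

      p≤c : p ≤ c
      p≤c = ≤-trans (m≤m+n p r) (≤-reflexive (sym c≡p+r))

      heavy⇒> : ∀ i → heavy i ≡ true → c < d i
      heavy⇒> i i∈ = <ᵇ≡true⇒< c (d i) (∧-conicalʳ (I i) _ i∈)

      light⇒≤ : ∀ i → light i ≡ true → d i ≤ c
      light⇒≤ i i∈ = <ᵇ≡false⇒≥ c (d i) (not-injective (∧-conicalʳ (I i) _ i∈))

      heavy⊆hi : heavy ⊆ hi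
      heavy⊆hi i i∈ = I⊆hi i (∧-conicalˡ (I i) _ i∈)

      light⊆hi∖heavy : light ⊆ hi ∖ heavy
      light⊆hi∖heavy i i∈ with I i in Ii | large i
      ... | true  | false = cong (_∧ true) (I⊆hi i Ii)
      ... | true  | true  = contradiction i∈ λ ()
      ... | false | _     = contradiction i∈ λ ()

      p≤d₁ : p ≤ ext n d 1
      p≤d₁ with ∣∣≡0⊎nonempty heavy
      ... | inj₁ p≡0      = ≤-trans (≤-reflexive p≡0) z≤n
      ... | inj₂ (i , i∈) = ≤-trans p≤c (≤-trans (<⇒≤ (heavy⇒> i i∈)) (antitone⇒≤ext₁ antitone i))

      r≤∑lo[d∸p] : r ≤ ∑[ i ∈ lo ] (d i ∸ p)
      r≤∑lo[d∸p] with ∣∣≡0⊎nonempty heavy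
      ... | inj₁ p≡0 = begin
        r                      ≡⟨ sym (trans c≡p+r (cong (_+ r) p≡0)) ⟩
        c                      ≤⟨ ⊆hi⇒∣∣≤ I⊆hi ⟩
        n ∸ γ                  ≤⟨ size ⟩
        ∑[ i ∈ lo ] d i        ≡⟨ sumOver-cong (λ i _ → cong (d i ∸_) (sym p≡0)) ⟩
        ∑[ i ∈ lo ] (d i ∸ p)  ∎
        where open ≤-Reasoning
      ... | inj₂ (i , i∈) = begin
        r                      ≡⟨ sym (trans (cong (_∸ p) c≡p+r) (m+n∸m≡n p r)) ⟩
        c ∸ p                  ≤⟨ ∸-monoˡ-≤ p (<⇒≤ (heavy⇒> i i∈)) ⟩
        d i ∸ p                ≤⟨ antitone⇒≤sumOver-below 1≤γ (λ j k j≤k → ∸-monoˡ-≤ p (antitone j k j≤k)) i ⟩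
        ∑[ i ∈ lo ] (d i ∸ p)  ∎
        where open ≤-Reasoning

      ∑-I-d : ∑[ i ∈ I ] d i ≡ ∑[ i ∈ heavy ] d i + (∑[ i ∈ light ] (d i ∸ 1) + r)
      ∑-I-d = trans (sumOver-split I large) (cong (∑[ i ∈ heavy ] d i +_) (sumOver-pred light λ i _ → d≥1 i))

      ∑-hi∖heavy-≤ : ∑[ i ∈ hi ∖ heavy ] (p ⊓ (d i ∸ 1)) ≤ p * r + ∑[ i ∈ hi ∖ I ] (c ⊓ (d i ∸ 1))
      ∑-hi∖heavy-≤ = begin
        ∑[ i ∈ hi ∖ heavy ] (p ⊓ (d i ∸ 1))
          ≡⟨ sumOver-split-⊆ light⊆hi∖heavy ⟩
        ∑[ i ∈ light ] (p ⊓ (d i ∸ 1)) + ∑[ i ∈ hi ∖ heavy ∖ light ] (p ⊓ (d i ∸ 1))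
          ≤⟨ +-mono-≤ (sumOver-≤-* light p λ i _ → m⊓n≤m p (d i ∸ 1))
                      (≤-trans (≤-reflexive (sumOver-≗ λ i → hi∖heavy∖light (hi i) (I i) (large i)))
                               (sumOver-mono λ i _ → ⊓-monoˡ-≤ (d i ∸ 1) p≤c)) ⟩
        r * p + ∑[ i ∈ hi ∖ I ] (c ⊓ (d i ∸ 1))
          ≡⟨ cong (_+ ∑[ i ∈ hi ∖ I ] (c ⊓ (d i ∸ 1))) (*-comm r p) ⟩
        p * r + ∑[ i ∈ hi ∖ I ] (c ⊓ (d i ∸ 1)) ∎
        where
        open ≤-Reasoning
        hi∖heavy∖light : ∀ h i g → (h ∧ not (i ∧ g)) ∧ not (i ∧ not g) ≡ h ∧ not i
        hi∖heavy∖light false _     _     = refl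
        hi∖heavy∖light true  false _     = refl
        hi∖heavy∖light true  true  true  = refl
        hi∖heavy∖light true  true  false = refl

      ∑-I-[c∸1]⊓[d∸1] : ∑[ i ∈ I ] ((c ∸ 1) ⊓ (d i ∸ 1)) ≡ p * (c ∸ 1) + ∑[ i ∈ light ] (d i ∸ 1)
      ∑-I-[c∸1]⊓[d∸1] = begin
        ∑[ i ∈ I ] ((c ∸ 1) ⊓ (d i ∸ 1))
          ≡⟨ sumOver-split I large ⟩
        ∑[ i ∈ heavy ] ((c ∸ 1) ⊓ (d i ∸ 1)) + ∑[ i ∈ light ] ((c ∸ 1) ⊓ (d i ∸ 1))
          ≡⟨ cong₂ _+_ (sumOver-cong λ i i∈ → m≤n⇒m⊓n≡m (∸-monoˡ-≤ 1 (<⇒≤ (heavy⇒> i i∈))))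
                       (sumOver-cong λ i i∈ → m≥n⇒m⊓n≡n (∸-monoˡ-≤ 1 (light⇒≤ i i∈))) ⟩
        ∑[ _ ∈ heavy ] (c ∸ 1) + ∑[ i ∈ light ] (d i ∸ 1)
          ≡⟨ cong (_+ ∑[ i ∈ light ] (d i ∸ 1)) (sumOver-const heavy (c ∸ 1)) ⟩
        p * (c ∸ 1) + ∑[ i ∈ light ] (d i ∸ 1) ∎
        where open ≡-Reasoning

      capacity-bound : ∑[ i ∈ I ] d i ≤ capacity I
      capacity-bound = begin
        ∑[ i ∈ I ] d i
          ≡⟨ ∑-I-d ⟩
        ∑[ i ∈ heavy ] d i + (Y + r)
          ≤⟨ +-monoˡ-≤ (Y + r) (subset-condition heavy heavy⊆hi (segment-conditions p p≤d₁)) ⟩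
        p * (p ∸ 1) + Lp + ∑[ i ∈ hi ∖ heavy ] (p ⊓ (d i ∸ 1)) + (Y + r)
          ≤⟨ +-monoˡ-≤ (Y + r) (+-monoʳ-≤ (p * (p ∸ 1) + Lp) ∑-hi∖heavy-≤) ⟩
        p * (p ∸ 1) + Lp + (p * r + Z) + (Y + r)
          ≡⟨ regroup (p * (p ∸ 1)) Lp (p * r) Z Y r ⟩
        Lp + r + (p * (p ∸ 1) + p * r + Y) + Z
          ≤⟨ +-monoˡ-≤ Z (+-monoˡ-≤ (p * (p ∸ 1) + p * r + Y) (sumOver-⊓-+ {f = d} lo p r r≤∑lo[d∸p])) ⟩
        ∑[ i ∈ lo ] ((p + r) ⊓ d i) + (p * (p ∸ 1) + p * r + Y) + Z
          ≡⟨ cong₂ (λ a b → a + (b + Y) + Z) (sumOver-cong λ i _ → cong (_⊓ d i) (sym c≡p+r))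
                   (trans (m*[m∸1]+m*n≡m*[m+n∸1] p r) (cong (λ a → p * (a ∸ 1)) (sym c≡p+r))) ⟩
        ∑[ i ∈ lo ] (c ⊓ d i) + (p * (c ∸ 1) + Y) + Z
          ≡⟨ cong (λ a → ∑[ i ∈ lo ] (c ⊓ d i) + a + Z) (sym ∑-I-[c∸1]⊓[d∸1]) ⟩
        ∑[ i ∈ lo ] (c ⊓ d i) + ∑[ i ∈ I ] ((c ∸ 1) ⊓ (d i ∸ 1)) + Z
          ≡⟨ sym (capacity-split I I⊆hi) ⟩
        capacity I ∎
        where
        open ≤-Reasoning
        Y Z Lp : ℕ
        Y  = ∑[ i ∈ light ] (d i ∸ 1)
        Z  = ∑[ i ∈ hi ∖ I ] (c ⊓ (d i ∸ 1))
        Lp = ∑[ i ∈ lo ] (p ⊓ d i)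
        regroup : ∀ a l q z y r → a + l + (q + z) + (y + r) ≡ l + r + (a + q + y) + z
        regroup = solve-∀

    capacity-condition⇔segment-conditions : CapacityCondition ⇔ SegmentConditions
    capacity-condition⇔segment-conditions = mk⇔
      (λ H → capacity-condition⇒size-bound d≥1 H , λ k _ → capacity-condition⇒segment-condition H k)
      (λ (size , segment-conditions) I I⊆hi → HeavyLight.capacity-bound size segment-conditions I I⊆hi)

lemma13 : (n : ℕ) (d : Fin n → ℕ) (γ : ℕ) →
    (∀ i → 1 ≤ d i) →
    (∀ i j → i ≤ᶠ j → d j ≤ d i) →
    1 ≤ γ → γ ≤ n →
    ((I J : Fin n → Bool) → (∀ i → I i ≡ true → γ ≤ toℕ i) →
        sumRange 1 n (ext n d) ≤ Network.cutCap n d γ (Network.F3set n d γ I J))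
    ⇔
    ((n ∸ γ ≤ sumRange 1 γ (ext n d)) ×
     (∀ k → k ≤ ext n d 1 →
        sumRange (γ + 1) (γ + k) (ext n d)
          ≤ k * (k ∸ 1) + sumRange 1 γ (λ i → k ⊓ ext n d i)
            + sumRange (γ + k + 1) n (λ i → k ⊓ (ext n d i ∸ 1))))
lemma13 n d γ d≥1 antitone 1≤γ γ≤n =
  ⇔-trans cut-condition⇔capacity-condition
    (⇔-trans (capacity-condition⇔segment-conditions d≥1 antitone 1≤γ γ≤n) segment-conditions⇔sequence-conditions)
  where open F3Cuts n d γ
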